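{- Let $k\ge 4$, $n=2k-1$, and let $\lambda\in\overline{\mathcal{U}}_{T_n}$. Then the Young diagram $Y_{S_\lambda}$ has exactly $3n-3$ cells; therefore the sum of the hook lengths of the cells on its main diagonal equals $3n-3$.
   Context: Partitions into distinct parts: $\lambda=(\lambda_1<\dots<\lambda_t)$, $t\ge2$, positive integers. Missing parts $\mathcal{M}_\lambda=\{1,\dots,\lambda_t\}\setminus\{\lambda_i\}$. $\lambda$ is unrefinable if no two distinct missing parts sum to a part of $\lambda$. Maximal: largest part is maximum among unrefinable partitions of the same integer. $\overline{\mathcal{U}}_N$: maximal unrefinable partitions of $N$ with $\#\mathcal{M}_\lambda=\lfloor\lambda_t/2\rfloor$ (for such $\lambda$ with $N=T_n$, $n\ge 6$, one has $\lambda_t=2n-4$). $T_n=n(n+1)/2$. $S_\lambda=\mathbb{N}_0\setminus\{\lambda_1,\dots,\lambda_t\}$, and $Y_{S_\lambda}$ is its Keith--Nath Young diagram (English convention): one row for each part $g$ of $\lambda$, rows ordered from top to bottom by decreasing $g$, the row of $g$ consisting of $\#\{s\in S_\lambda:s<g\}$ left-justified cells. Hook length of a cell = (cells to its right) + (cells below it) + 1. -}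

module Defs where

open import Data.Nat using (ℕ; zero; suc; _+_; _*_; _∸_; _≤_; _<_; _<?_; _≟_)
open import Data.Nat.DivMod using (_/_)
open import Data.Nat.ListAction using (sum)
open import Data.List using (List; []; _∷_; length; map; filter; upTo; reverse)
open import Data.List.Relation.Unary.All using (All)
open import Data.List.Relation.Unary.Linked using (Linked)
open import Data.List.Membership.DecPropositional _≟_ using (_∈_; _∉_; _∈?_)
open import Data.Product using (_×_)
open import Relation.Nullary using (¬_)
open import Relation.Nullary.Decidable using (¬?)
open import Relation.Binary.PropositionalEquality using (_≡_; _≢_)

T : ℕ → ℕ
T n = (n * suc n) / 2

IsDistinctPartition : List ℕ → Set
IsDistinctPartition xs = Linked _<_ xs × All (λ x → 0 < x) xs × 2 ≤ length xs

-- largest part λ_t (last element of the increasing list; 0 for [])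
largest : List ℕ → ℕ
largest []           = 0
largest (x ∷ [])     = x
largest (x ∷ y ∷ ys) = largest (y ∷ ys)

oneTo : ℕ → List ℕ
oneTo m = map suc (upTo m)

missing : List ℕ → List ℕ
missing xs = filter (λ m → ¬? (m ∈? xs)) (oneTo (largest xs))

Unrefinable : List ℕ → Set
Unrefinable xs = ∀ a b → a ∈ missing xs → b ∈ missing xs → a ≢ b → (a + b) ∉ xs

MaximalUnrefinable : ℕ → List ℕ → Set
MaximalUnrefinable N xs =
  IsDistinctPartition xs × sum xs ≡ N × Unrefinable xs ×
  (∀ ys → IsDistinctPartition ys → sum ys ≡ N → Unrefinable ys → largest ys ≤ largest xs)

InUbar : ℕ → List ℕ → Set
InUbar N xs = MaximalUnrefinable N xs × length (missing xs) ≡ largest xs / 2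

-- Keith–Nath Young diagram of S_λ = ℕ₀ ∖ {λ_i}: row lengths top to bottom,
-- one row per part g (decreasing g), length #{s ∈ S_λ : s < g}.
rowLength : List ℕ → ℕ → ℕ
rowLength xs g = length (filter (λ s → ¬? (s ∈? xs)) (upTo g))

youngRows : List ℕ → List ℕ
youngRows xs = map (rowLength xs) (reverse xs)

cells : List ℕ → ℕ
cells rows = sum rows

-- sum of hook lengths of the diagonal cells (d,d); rows listed top to bottom,
-- d is the index of the current row. Hook of (d,d) = arm + leg + 1 where
-- arm = r_d - d - 1, leg = #{rows below with length > d}.
diagHookSumFrom : ℕ → List ℕ → ℕ
diagHookSumFrom d [] = 0
diagHookSumFrom d (r ∷ rs) with d <? r
... | Relation.Nullary.yes _ = ((r ∸ suc d) + length (filter (λ r' → d <? r') rs) + 1) + diagHookSumFrom (suc d) rs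
... | Relation.Nullary.no _  = diagHookSumFrom (suc d) rs

diagHookSum : List ℕ → ℕ
diagHookSum rows = diagHookSumFrom 0 rows

{-# OPTIONS --safe #-}

-- Write m for the largest part of λ and t for the number of parts, and encode λ by the
-- indicator χ of its parts on [0, m].  Row g of Y_{S_λ} has g − #{parts < g} cells, so
-- |Y| = Σλ − (0 + 1 + ⋯ + (t − 1)).  For λ ∈ Ū_{T n}, #M = m − t = ⌊m/2⌋ gives t = ⌈m/2⌉;
-- maximality against (1, …, n − 3, n + 1, 2n − 4) gives m ≥ 2n − 4, so t ≥ n − 2; and
-- |Y| ≥ m together with Σλ = T n gives t ≤ n − 1.  If t = n − 1, unrefinability and
-- #M = ⌊m/2⌋ force every pair {a, m − a} with a < m − a to contain exactly one part (and m/2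
-- to be missing), so Σλ = T (t − 1) + m + Σ (m − 2a) over the pairs whose upper element is a
-- part; Σλ = T n then writes 1 as a sum of even numbers (m even) or 2 as a sum of distinct
-- odd numbers (m odd).  Hence t = n − 2 and |Y| = T n − T (n − 3) = 3n − 3.  The hooks of the
-- diagonal cells of a Young diagram are disjoint and cover it, so they sum to its size.

module Submission where

open import Data.Nat using (ℕ; zero; suc; _+_; _*_; _∸_; _≤_; _<_; _≥_; z≤n; s≤s; _≟_; _<?_)
open import Data.Nat.DivMod using (_/_; _%_; m*n/n≡m; m%n<n; m≡m%n+[m/n]*n)
open import Data.Nat.ListAction using (sum)
open import Data.Nat.ListAction.Properties using (sum-↭; sum-++)
open import Data.Nat.Properties
open import Algebra.Properties.CommutativeSemigroup +-commutativeSemigroup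
  using () renaming (interchange to +-interchange; xy∙z≈xz∙y to +-rightComm; x∙yz≈y∙xz to +-leftComm)
open import Data.Nat.Tactic.RingSolver using (solve-∀)
open import Data.List using (List; []; _∷_; [_]; length; map; filter; applyUpTo; reverse; _++_)
open import Data.List.Membership.DecPropositional _≟_ using (_∈_; _∉_; _∈?_)
open import Data.List.Membership.Propositional.Properties
  using (∈-filter⁺; ∈-filter⁻; ∈-map⁺; ∈-map⁻; ∈-upTo⁺; ∈-applyUpTo⁺; ∈-++⁺ˡ)
open import Data.List.Properties
  using (unfold-reverse; map-upTo; map-id; reverse-map; filter-accept; filter-reject; length-++)
open import Data.List.Relation.Binary.Permutation.Propositional.Properties using (↭-reverse)
open import Data.List.Relation.Unary.All using (All; []; _∷_)
import Data.List.Relation.Unary.All as All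
import Data.List.Relation.Unary.All.Properties as All
open import Data.List.Relation.Unary.AllPairs using (AllPairs; []; _∷_)
import Data.List.Relation.Unary.AllPairs as AllPairs
import Data.List.Relation.Unary.AllPairs.Properties as AllPairs
open import Data.List.Relation.Unary.Any using (here; there; toSum)
import Data.List.Relation.Unary.Any.Properties as Any
open import Data.List.Relation.Unary.Linked using (Linked; []; [-]; _∷_)
open import Data.List.Relation.Unary.Linked.Properties using (Linked⇒AllPairs; AllPairs⇒Linked)
open import Data.List.Relation.Unary.Unique.Propositional using (Unique)
open import Data.Product using (_×_; _,_; proj₁; proj₂)
open import Data.Sum using (_⊎_; inj₁; inj₂; [_,_]′)
open import Function using (_∘_; id; flip)
open import Relation.Binary.Definitions using (tri<; tri≈; tri>)
open import Relation.Binary.PropositionalEquality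
  using (_≡_; _≢_; refl; sym; trans; cong; cong₂; subst; subst₂; module ≡-Reasoning)
open import Relation.Nullary using (Dec; yes; no; contradiction)
open import Relation.Nullary.Decidable using (¬?)

open import Defs

h*2≡h+h : ∀ h → h * 2 ≡ h + h
h*2≡h+h h = trans (*-comm h 2) (cong (h +_) (+-identityʳ h))

half-parity : ∀ n → n ≡ n / 2 + n / 2 ⊎ n ≡ suc (n / 2 + n / 2)
half-parity n with n % 2 | m%n<n n 2 | trans (m≡m%n+[m/n]*n n 2) (cong (n % 2 +_) (h*2≡h+h (n / 2)))
... | zero        | _            | n≡ = inj₁ n≡
... | suc zero    | _            | n≡ = inj₂ n≡
... | suc (suc _) | s≤s (s≤s ()) | _

ordered-pair-sum : ∀ {a i} → a ≤ i → a + (a + 2 * (i ∸ a)) ≡ i + i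
ordered-pair-sum {a} {i} a≤i = begin
  a + (a + 2 * (i ∸ a))          ≡⟨ rearrange a (i ∸ a) ⟩
  (a + (i ∸ a)) + (a + (i ∸ a))  ≡⟨ cong (λ k → k + k) (m+[n∸m]≡n a≤i) ⟩
  i + i                          ∎
  where
  open ≡-Reasoning
  rearrange : ∀ a e → a + (a + 2 * e) ≡ (a + e) + (a + e)
  rearrange = solve-∀

distinct-sum : ∀ {k a b} → k ≤ a → k ≤ b → a ≢ b → suc (k + k) ≤ a + b
distinct-sum {k} {a} {b} k≤a k≤b a≢b with <-cmp a b
... | tri< a<b _ _ = subst (_≤ a + b) (+-suc k k) (+-mono-≤ k≤a (<-≤-trans (s≤s k≤a) a<b))
... | tri≈ _ a≡b _ = contradiction a≡b a≢b
... | tri> _ _ b<a = subst₂ _≤_ (+-suc k k) (+-comm b a) (+-mono-≤ k≤b (<-≤-trans (s≤s k≤b) b<a))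

half-≤ : ∀ {a t} → a + a ≤ t + t → a ≤ t
half-≤ a+a≤t+t = ≮⇒≥ λ t<a → <⇒≱ (+-mono-< t<a t<a) a+a≤t+t

≤∧<2+∧≢1+⇒≡ : ∀ {a t} → a ≤ t → t < 2 + a → t ≢ 1 + a → t ≡ a
≤∧<2+∧≢1+⇒≡ a≤t t<2+a t≢1+a with m≤n⇒m<n∨m≡n a≤t
... | inj₁ a<t = contradiction (≤-antisym (≤-pred t<2+a) a<t) t≢1+a
... | inj₂ a≡t = sym a≡t

-- Finite sums

∑< : ℕ → (ℕ → ℕ) → ℕ
∑< zero    f = 0
∑< (suc n) f = ∑< n f + f n

-- ∑[ x < n ] binds tighter than every arithmetic operator: compound bodies need parentheses.
infix 8 ∑<
syntax ∑< n (λ x → e) = ∑[ x < n ] e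

∑-cong : ∀ n {f g : ℕ → ℕ} → (∀ x → x < n → f x ≡ g x) → ∑< n f ≡ ∑< n g
∑-cong zero    _  = refl
∑-cong (suc n) eq = cong₂ _+_ (∑-cong n (λ x x<n → eq x (m<n⇒m<1+n x<n))) (eq n ≤-refl)

∑-mono-≤ : ∀ n {f g : ℕ → ℕ} → (∀ x → x < n → f x ≤ g x) → ∑< n f ≤ ∑< n g
∑-mono-≤ zero    _  = z≤n
∑-mono-≤ (suc n) le = +-mono-≤ (∑-mono-≤ n (λ x x<n → le x (m<n⇒m<1+n x<n))) (le n ≤-refl)

∑-distrib-+ : ∀ n {f g : ℕ → ℕ} → ∑[ x < n ] (f x + g x) ≡ ∑< n f + ∑< n g
∑-distrib-+ zero    = refl
∑-distrib-+ (suc n) {f} {g} = begin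
  ∑[ x < n ] (f x + g x) + (f n + g n) ≡⟨ cong (_+ (f n + g n)) (∑-distrib-+ n) ⟩
  ∑< n f + ∑< n g + (f n + g n)        ≡⟨ +-interchange (∑< n f) _ _ _ ⟩
  ∑< n f + f n + (∑< n g + g n)        ∎
  where open ≡-Reasoning

∑-distribˡ-* : ∀ k n {f : ℕ → ℕ} → ∑[ x < n ] (k * f x) ≡ k * ∑< n f
∑-distribˡ-* k zero    = sym (*-zeroʳ k)
∑-distribˡ-* k (suc n) {f} = trans (cong (_+ k * f n) (∑-distribˡ-* k n)) (sym (*-distribˡ-+ k _ (f n)))

∑-shift : ∀ n {f : ℕ → ℕ} → ∑< (suc n) f ≡ f 0 + ∑[ x < n ] f (suc x)
∑-shift zero    {f} = +-comm 0 (f 0)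
∑-shift (suc n) {f} = trans (cong (_+ f (suc n)) (∑-shift n)) (+-assoc (f 0) _ _)

∑-split : ∀ m n {f : ℕ → ℕ} → ∑< (m + n) f ≡ ∑< m f + ∑[ x < n ] f (m + x)
∑-split m zero    {f} = trans (cong (λ k → ∑< k f) (+-identityʳ m)) (sym (+-identityʳ _))
∑-split m (suc n) {f} = begin
  ∑< (m + suc n) f                         ≡⟨ cong (λ k → ∑< k f) (+-suc m n) ⟩
  ∑< (m + n) f + f (m + n)                 ≡⟨ cong (_+ f (m + n)) (∑-split m n) ⟩
  ∑< m f + ∑[ x < n ] f (m + x) + f (m + n) ≡⟨ +-assoc (∑< m f) _ _ ⟩
  ∑< m f + ∑[ x < suc n ] f (m + x)        ∎
  where open ≡-Reasoning

∑-reverse : ∀ n {f : ℕ → ℕ} → ∑< n f ≡ ∑[ x < n ] f (n ∸ suc x)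
∑-reverse zero    = refl
∑-reverse (suc n) {f} = begin
  ∑< n f + f n                          ≡⟨ cong (_+ f n) (∑-reverse n) ⟩
  ∑[ x < n ] f (n ∸ suc x) + f n        ≡⟨ +-comm _ (f n) ⟩
  f n + ∑[ x < n ] f (n ∸ suc x)        ≡⟨ ∑-shift n ⟨
  ∑[ x < suc n ] f (suc n ∸ suc x)      ∎
  where open ≡-Reasoning

∑-prefix-≤ : ∀ {m n} {f : ℕ → ℕ} → m ≤ n → ∑< m f ≤ ∑< n f
∑-prefix-≤ {m} {n} {f} m≤n with m≤n⇒∃[o]m+o≡n m≤n
... | o , refl = ≤-trans (m≤m+n (∑< m f) _) (≤-reflexive (sym (∑-split m o)))

∑-const : ∀ n k → ∑[ x < n ] k ≡ n * k
∑-const zero    k = refl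
∑-const (suc n) k = trans (cong (_+ k) (∑-const n k)) (+-comm (n * k) k)

∑-≤-count : ∀ n {f : ℕ → ℕ} → (∀ x → x < n → f x ≤ 1) → ∑< n f ≤ n
∑-≤-count n f≤1 = ≤-trans (∑-mono-≤ n f≤1) (≤-reflexive (trans (∑-const n 1) (*-identityʳ n)))

∑-saturated : ∀ n {f : ℕ → ℕ} → (∀ x → x < n → f x ≤ 1) → n ≤ ∑< n f → ∀ x → x < n → f x ≡ 1
∑-saturated (suc n) {f} f≤1 full x x<1+n =
  [ (λ x<n → ∑-saturated n f≤1′ (proj₁ last-full) x x<n)
  , (λ x≡n → subst (λ y → f y ≡ 1) (sym x≡n) (proj₂ last-full))
  ]′ (m≤n⇒m<n∨m≡n (≤-pred x<1+n))
  where
  f≤1′ : ∀ y → y < n → f y ≤ 1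
  f≤1′ y y<n = f≤1 y (m<n⇒m<1+n y<n)
  last-full : n ≤ ∑< n f × f n ≡ 1
  last-full = split (∑-≤-count n f≤1′) (f≤1 n ≤-refl) full
    where
    split : ∀ {s v} → s ≤ n → v ≤ 1 → suc n ≤ s + v → n ≤ s × v ≡ 1
    split {s} {zero}     s≤n _ le = contradiction (subst (suc n ≤_) (+-identityʳ s) le) (≤⇒≯ s≤n)
    split {s} {suc zero} _   _ le = ≤-pred (subst (suc n ≤_) (+-comm s 1) le) , refl
    split {v = suc (suc _)} _ (s≤s ()) _

∑-pairUp : ∀ j {g : ℕ → ℕ} → ∑< (j + j) g ≡ ∑[ a < j ] (g a + g (a + suc (2 * (j ∸ suc a))))
∑-pairUp j {g} = begin
  ∑< (j + j) g                             ≡⟨ ∑-split j j ⟩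
  ∑< j g + ∑[ x < j ] g (j + x)            ≡⟨ cong (∑< j g +_) (∑-reverse j) ⟩
  ∑< j g + ∑[ a < j ] g (j + (j ∸ suc a))  ≡⟨ ∑-distrib-+ j ⟨
  ∑[ a < j ] (g a + g (j + (j ∸ suc a)))   ≡⟨ ∑-cong j (λ a a<j → cong (λ y → g a + g y) (partner a<j)) ⟩
  ∑[ a < j ] (g a + g (a + suc (2 * (j ∸ suc a)))) ∎
  where
  open ≡-Reasoning
  partner : ∀ {a} → a < j → j + (j ∸ suc a) ≡ a + suc (2 * (j ∸ suc a))
  partner {a} a<j = begin
    j + (j ∸ suc a)                    ≡⟨ cong (_+ (j ∸ suc a)) (m+[n∸m]≡n a<j) ⟨
    suc a + (j ∸ suc a) + (j ∸ suc a)  ≡⟨ rearrange a (j ∸ suc a) ⟩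
    a + suc (2 * (j ∸ suc a))          ∎
    where
    rearrange : ∀ a e → suc a + e + e ≡ a + suc (2 * e)
    rearrange = solve-∀

∑-pairUp-odd : ∀ j {g : ℕ → ℕ} → ∑< (suc (j + j)) g ≡ ∑[ a < j ] (g a + g (a + 2 * (j ∸ a))) + g j
∑-pairUp-odd j {g} = begin
  ∑< (suc j + j) g                                  ≡⟨ ∑-split (suc j) j ⟩
  ∑< j g + g j + ∑[ x < j ] g (suc j + x)           ≡⟨ cong (∑< j g + g j +_) (∑-reverse j) ⟩
  ∑< j g + g j + ∑[ a < j ] g (suc j + (j ∸ suc a)) ≡⟨ +-rightComm (∑< j g) (g j) _ ⟩
  ∑< j g + ∑[ a < j ] g (suc j + (j ∸ suc a)) + g j ≡⟨ cong (_+ g j) (∑-distrib-+ j) ⟨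
  ∑[ a < j ] (g a + g (suc j + (j ∸ suc a))) + g j  ≡⟨ cong (_+ g j) (∑-cong j (λ a a<j → cong (λ y → g a + g y) (partner a<j))) ⟩
  ∑[ a < j ] (g a + g (a + 2 * (j ∸ a))) + g j      ∎
  where
  open ≡-Reasoning
  partner : ∀ {a} → a < j → suc j + (j ∸ suc a) ≡ a + 2 * (j ∸ a)
  partner {a} a<j = begin
    suc j + (j ∸ suc a)                ≡⟨ cong (λ k → suc k + (j ∸ suc a)) (m+[n∸m]≡n a<j) ⟨
    suc (suc a + (j ∸ suc a) + (j ∸ suc a)) ≡⟨ rearrange a (j ∸ suc a) ⟩
    a + 2 * suc (j ∸ suc a)            ≡⟨ cong (λ e → a + 2 * e) (+-∸-assoc 1 a<j) ⟨
    a + 2 * (j ∸ a)                    ∎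
    where
    rearrange : ∀ a e → suc (suc a + e + e) ≡ a + 2 * suc e
    rearrange = solve-∀

∑-odd-weights≢2 : ∀ n {w : ℕ → ℕ} → (∀ a → w a ≤ 1) → ∑[ a < n ] (suc (2 * (n ∸ suc a)) * w a) ≢ 2
∑-odd-weights≢2 (suc zero) {w} w≤1 sum≡2 with w 0 | w≤1 0 | sum≡2
... | zero          | _        | ()
... | suc zero      | _        | ()
... | suc (suc _)   | s≤s () | _
∑-odd-weights≢2 (suc (suc n)) {w} w≤1 sum≡2 =
  ∑-odd-weights≢2 (suc n) (w≤1 ∘ suc) (trans (cong (_+ rest) (sym (head≡0 (w 0) (w≤1 0) refl))) head+rest≡2)
  where
  head : ℕ
  head = suc (2 * suc n)
  rest : ℕ
  rest = ∑[ a < suc n ] (suc (2 * (suc n ∸ suc a)) * w (suc a))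
  head+rest≡2 : head * w 0 + rest ≡ 2
  head+rest≡2 = trans (sym (∑-shift (suc n))) sum≡2
  head≡0 : ∀ v → v ≤ 1 → w 0 ≡ v → head * w 0 ≡ 0
  head≡0 zero          _      w0≡0 = trans (cong (head *_) w0≡0) (*-zeroʳ head)
  head≡0 (suc zero)    _      w0≡1 = contradiction (trans (rearrange n rest) (subst (λ v → head * v + rest ≡ 2) w0≡1 head+rest≡2)) λ ()
    where
    rearrange : ∀ n r → 3 + (2 * n + r) ≡ suc (2 * suc n) * 1 + r
    rearrange = solve-∀
  head≡0 (suc (suc _)) (s≤s ()) _

-- tri n = 0 + 1 + ⋯ + (n − 1), one index behind T.
tri : ℕ → ℕ
tri n = ∑[ x < n ] x

∑-suc≡tri : ∀ n → ∑[ x < n ] suc x ≡ tri (suc n)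
∑-suc≡tri n = sym (∑-shift n)

tri-mono-≤ : ∀ {m n} → m ≤ n → tri m ≤ tri n
tri-mono-≤ = ∑-prefix-≤

tri-bound : ∀ {s t} → 2 ≤ s → tri t + (t + t) ≤ suc (tri (suc s)) → t < s
tri-bound {s} {t} 2≤s bound = ≰⇒> λ s≤t →
  <⇒≱ too-big (≤-trans (+-mono-≤ (tri-mono-≤ s≤t) (+-mono-≤ s≤t s≤t)) bound)
  where
  too-big : suc (tri (suc s)) < tri s + (s + s)
  too-big = subst (_< tri s + (s + s)) (+-suc (tri s) s) (+-monoʳ-< (tri s) (+-monoˡ-≤ s 2≤s))

T≡tri : ∀ n → T n ≡ tri (suc n)
T≡tri n = trans (cong (_/ 2) (sym (tri*2 n))) (m*n/n≡m (tri (suc n)) 2)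
  where
  tri*2 : ∀ n → tri (suc n) * 2 ≡ n * suc n
  tri*2 zero    = refl
  tri*2 (suc n) = begin
    (tri (suc n) + suc n) * 2      ≡⟨ *-distribʳ-+ 2 (tri (suc n)) (suc n) ⟩
    tri (suc n) * 2 + suc n * 2    ≡⟨ cong (_+ suc n * 2) (tri*2 n) ⟩
    n * suc n + suc n * 2          ≡⟨ rearrange n ⟩
    suc n * suc (suc n)            ∎
    where
    open ≡-Reasoning
    rearrange : ∀ n → n * suc n + suc n * 2 ≡ suc n * suc (suc n)
    rearrange = solve-∀

module _ {f g : ℕ → ℕ} (f+g≡1 : ∀ x → f x + g x ≡ 1) where

  ∑-complement : ∀ n → ∑< n f + ∑< n g ≡ n
  ∑-complement n = begin
    ∑< n f + ∑< n g           ≡⟨ ∑-distrib-+ n ⟨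
    ∑[ x < n ] (f x + g x)    ≡⟨ ∑-cong n (λ x _ → f+g≡1 x) ⟩
    ∑[ x < n ] 1              ≡⟨ ∑-const n 1 ⟩
    n * 1                     ≡⟨ *-identityʳ n ⟩
    n                         ∎
    where open ≡-Reasoning

  -- The k-th x with f x = 1 (counting from 0) is k plus the number of earlier x with g x = 1.
  ∑-positions : ∀ n → ∑[ x < n ] (f x * x) ≡ tri (∑< n f) + ∑[ x < n ] (f x * ∑< x g)
  ∑-positions zero    = refl
  ∑-positions (suc n) = begin
    ∑[ x < n ] (f x * x) + f n * n                  ≡⟨ cong (_+ f n * n) (∑-positions n) ⟩
    tri s + c + f n * n                           ≡⟨ cong (λ y → tri s + c + f n * y) (∑-complement n) ⟨
    tri s + c + f n * (s + ∑< n g)                ≡⟨ add-position (f n) (f+g≡1 n) ⟩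
    tri (s + f n) + (c + f n * ∑< n g)            ∎
    where
    open ≡-Reasoning
    s c : ℕ
    s = ∑< n f
    c = ∑[ x < n ] (f x * ∑< x g)
    add-position : ∀ v → v + g n ≡ 1 → tri s + c + v * (s + ∑< n g) ≡ tri (s + v) + (c + v * ∑< n g)
    add-position zero       _ = trans (+-identityʳ _) (sym (cong₂ (λ a b → tri a + b) (+-identityʳ s) (+-identityʳ c)))
    add-position (suc zero) _ = begin
      tri s + c + (s + ∑< n g + 0)   ≡⟨ rearrange (tri s) c s (∑< n g) ⟩
      tri s + s + (c + (∑< n g + 0)) ≡⟨ cong (λ a → tri a + (c + (∑< n g + 0))) (+-comm 1 s) ⟩
      tri (s + 1) + (c + (∑< n g + 0)) ∎
      where
      rearrange : ∀ t c s r → t + c + (s + r + 0) ≡ t + s + (c + (r + 0))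
      rearrange = solve-∀
    add-position (suc (suc _)) ()

-- Indicator functions of lists

χ : List ℕ → ℕ → ℕ
χ xs x with x ∈? xs
... | yes _ = 1
... | no  _ = 0

χᶜ : List ℕ → ℕ → ℕ
χᶜ xs x with x ∈? xs
... | yes _ = 0
... | no  _ = 1

module _ {xs : List ℕ} where

  χ+χᶜ≡1 : ∀ x → χ xs x + χᶜ xs x ≡ 1
  χ+χᶜ≡1 x with x ∈? xs
  ... | yes _ = refl
  ... | no  _ = refl

  χ≤1 : ∀ x → χ xs x ≤ 1
  χ≤1 x = subst (χ xs x ≤_) (χ+χᶜ≡1 x) (m≤m+n (χ xs x) (χᶜ xs x))

  χᶜ≤1 : ∀ x → χᶜ xs x ≤ 1
  χᶜ≤1 x = subst (χᶜ xs x ≤_) (χ+χᶜ≡1 x) (m≤n+m (χᶜ xs x) (χ xs x))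

  χ-∈ : ∀ {x} → x ∈ xs → χ xs x ≡ 1
  χ-∈ {x} x∈xs with x ∈? xs
  ... | yes _    = refl
  ... | no  x∉xs = contradiction x∈xs x∉xs

  χ-∉ : ∀ {x} → x ∉ xs → χ xs x ≡ 0
  χ-∉ {x} x∉xs with x ∈? xs
  ... | yes x∈xs = contradiction x∈xs x∉xs
  ... | no  _    = refl

  χᶜ-∈ : ∀ {x} → x ∈ xs → χᶜ xs x ≡ 0
  χᶜ-∈ {x} x∈xs = +-cancelˡ-≡ 1 _ _ (trans (cong (_+ χᶜ xs x) (sym (χ-∈ x∈xs))) (χ+χᶜ≡1 x))

  χᶜ-∉ : ∀ {x} → x ∉ xs → χᶜ xs x ≡ 1
  χᶜ-∉ {x} x∉xs = trans (cong (_+ χᶜ xs x) (sym (χ-∉ x∉xs))) (χ+χᶜ≡1 x)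

  χᶜ≡1⇒∉ : ∀ {x} → χᶜ xs x ≡ 1 → x ∉ xs
  χᶜ≡1⇒∉ {x} χᶜ≡1 with x ∈? xs | χᶜ≡1
  ... | yes _    | ()
  ... | no  x∉xs | _  = x∉xs

χ-∷ : ∀ {y ys} x → y ∉ ys → χ (y ∷ ys) x ≡ χ [ y ] x + χ ys x
χ-∷ {y} {ys} x y∉ys = by-cases (x ≟ y) (x ∈? ys)
  where
  by-cases : Dec (x ≡ y) → Dec (x ∈ ys) → χ (y ∷ ys) x ≡ χ [ y ] x + χ ys x
  by-cases (yes x≡y) _ =
    trans (χ-∈ (here x≡y)) (sym (cong₂ _+_ (χ-∈ (here x≡y)) (χ-∉ (subst (_∉ ys) (sym x≡y) y∉ys))))
  by-cases (no x≢y) (yes x∈ys) =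
    trans (χ-∈ (there x∈ys)) (sym (cong₂ _+_ (χ-∉ ([ x≢y , (λ ()) ]′ ∘ toSum)) (χ-∈ x∈ys)))
  by-cases (no x≢y) (no x∉ys) =
    trans (χ-∉ ([ x≢y , x∉ys ]′ ∘ toSum)) (sym (cong₂ _+_ (χ-∉ ([ x≢y , (λ ()) ]′ ∘ toSum)) (χ-∉ x∉ys)))

∑-χ-singleton : ∀ B {y} (f : ℕ → ℕ) → y < B → ∑[ x < B ] (χ [ y ] x * f x) ≡ f y
∑-χ-singleton (suc B) {y} f y<1+B with m≤n⇒m<n∨m≡n (≤-pred y<1+B)
... | inj₁ y<B  = begin
  ∑[ x < B ] (χ [ y ] x * f x) + χ [ y ] B * f B ≡⟨ cong₂ _+_ (∑-χ-singleton B f y<B) (cong (_* f B) (χ-∉ {[ y ]} B∉[y])) ⟩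
  f y + 0                                         ≡⟨ +-identityʳ (f y) ⟩
  f y                                             ∎
  where
  open ≡-Reasoning
  B∉[y] : B ∉ [ y ]
  B∉[y] (here B≡y) = <⇒≢ y<B (sym B≡y)
... | inj₂ refl = begin
  ∑[ x < y ] (χ [ y ] x * f x) + χ [ y ] y * f y
    ≡⟨ cong₂ _+_ (∑-cong y (λ x x<y → cong (_* f x) (χ-∉ {[ y ]} (x∉[y] x<y)))) (cong (_* f y) (χ-∈ {[ y ]} (here refl))) ⟩
  ∑[ x < y ] 0 + 1 * f y                          ≡⟨ cong₂ _+_ (trans (∑-const y 0) (*-zeroʳ y)) (*-identityˡ (f y)) ⟩
  f y                                             ∎
  where
  open ≡-Reasoning
  x∉[y] : ∀ {x} → x < y → x ∉ [ y ]
  x∉[y] x<y (here x≡y) = <⇒≢ x<y x≡y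

sum-map≡∑χ : ∀ {xs} B (f : ℕ → ℕ) → Unique xs → All (_< B) xs → sum (map f xs) ≡ ∑[ x < B ] (χ xs x * f x)
sum-map≡∑χ {[]}     B f _ _ = sym (trans (∑-const B 0) (*-zeroʳ B))
sum-map≡∑χ {y ∷ ys} B f (y∉ys ∷ unique) (y<B ∷ ys<B) = begin
  f y + sum (map f ys)                                          ≡⟨ cong₂ _+_ (∑-χ-singleton B f y<B) (sym (sum-map≡∑χ B f unique ys<B)) ⟨
  ∑[ x < B ] (χ [ y ] x * f x) + ∑[ x < B ] (χ ys x * f x)    ≡⟨ ∑-distrib-+ B ⟨
  ∑[ x < B ] (χ [ y ] x * f x + χ ys x * f x)                 ≡⟨ ∑-cong B (λ x _ → *-distribʳ-+ (f x) (χ [ y ] x) (χ ys x)) ⟨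
  ∑[ x < B ] ((χ [ y ] x + χ ys x) * f x)                     ≡⟨ ∑-cong B (λ x _ → cong (_* f x) (χ-∷ x (All.All¬⇒¬Any y∉ys))) ⟨
  ∑[ x < B ] (χ (y ∷ ys) x * f x)                             ∎
  where open ≡-Reasoning

sum-applyUpTo : ∀ n (f : ℕ → ℕ) → sum (applyUpTo f n) ≡ ∑< n f
sum-applyUpTo zero    f = refl
sum-applyUpTo (suc n) f = trans (cong (f 0 +_) (sum-applyUpTo n (f ∘ suc))) (sym (∑-shift n))

length-filter-∉ : ∀ xs n (h : ℕ → ℕ) → length (filter (λ s → ¬? (s ∈? xs)) (applyUpTo h n)) ≡ ∑[ x < n ] χᶜ xs (h x)
length-filter-∉ xs zero    h = refl
length-filter-∉ xs (suc n) h = trans count-head (sym (∑-shift n))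
  where
  count-head : length (filter (λ s → ¬? (s ∈? xs)) (h 0 ∷ applyUpTo (h ∘ suc) n)) ≡ χᶜ xs (h 0) + ∑[ x < n ] χᶜ xs (h (suc x))
  count-head with h 0 ∈? xs
  ... | yes _ = length-filter-∉ xs n (h ∘ suc)
  ... | no  _ = cong suc (length-filter-∉ xs n (h ∘ suc))

All-reverse⁺ : ∀ {A : Set} {P : A → Set} {xs} → All P xs → All P (reverse xs)
All-reverse⁺ pxs = All.tabulate (All.lookup pxs ∘ Any.reverse⁻)

AllPairs-reverse⁺ : ∀ {A : Set} {R : A → A → Set} {xs} → AllPairs R xs → AllPairs (flip R) (reverse xs)
AllPairs-reverse⁺         {xs = []}     []              = []
AllPairs-reverse⁺ {R = R} {xs = x ∷ xs} (x~xs ∷ pairs) =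
  subst (AllPairs (flip R)) (sym (unfold-reverse x xs))
        (AllPairs.++⁺ (AllPairs-reverse⁺ pairs) ([] ∷ []) (All-reverse⁺ (All.map (_∷ []) x~xs)))

largest-∈ : ∀ {xs} → 0 < length xs → largest xs ∈ xs
largest-∈ {x ∷ []}     _ = here refl
largest-∈ {x ∷ y ∷ ys} _ = there (largest-∈ {y ∷ ys} (s≤s z≤n))

largest-++ : ∀ xs y ys → largest (xs ++ y ∷ ys) ≡ largest (y ∷ ys)
largest-++ []           y ys = refl
largest-++ (x ∷ [])     y ys = refl
largest-++ (x ∷ x′ ∷ xs) y ys = largest-++ (x′ ∷ xs) y ys

≤-largest : ∀ {xs} → Linked _<_ xs → All (_≤ largest xs) xs
≤-largest {[]}         []            = []
≤-largest {x ∷ []}     [-]           = ≤-refl ∷ []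
≤-largest {x ∷ y ∷ ys} (x<y ∷ sorted) with ≤-largest sorted
... | y≤ ∷ ys≤ = ≤-trans (<⇒≤ x<y) y≤ ∷ y≤ ∷ ys≤

∈-missing : ∀ {xs x} → 0 < x → x ≤ largest xs → x ∉ xs → x ∈ missing xs
∈-missing {xs} {suc x} _ x<m x∉xs =
  ∈-filter⁺ (λ s → ¬? (s ∈? xs)) (∈-map⁺ suc (∈-upTo⁺ x<m)) x∉xs

∈-missing⁻ : ∀ {xs x} → x ∈ missing xs → 0 < x × x ∉ xs
∈-missing⁻ {xs} x∈ with ∈-filter⁻ (λ s → ¬? (s ∈? xs)) {xs = oneTo (largest xs)} x∈
... | x∈oneTo , x∉xs with ∈-map⁻ suc x∈oneTo
...   | _ , _ , refl = s≤s z≤n , x∉xs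

-- Young diagrams

rowLength≡∑ : ∀ xs g → rowLength xs g ≡ ∑[ x < g ] χᶜ xs x
rowLength≡∑ xs g = length-filter-∉ xs g id

rowLength-mono-≤ : ∀ xs {g h} → g ≤ h → rowLength xs g ≤ rowLength xs h
rowLength-mono-≤ xs {g} {h} g≤h =
  subst₂ _≤_ (sym (rowLength≡∑ xs g)) (sym (rowLength≡∑ xs h)) (∑-prefix-≤ g≤h)

youngRows-decreasing : ∀ {xs} → Linked _<_ xs → AllPairs _≥_ (youngRows xs)
youngRows-decreasing {xs} sorted =
  AllPairs.map⁺ (AllPairs.map (rowLength-mono-≤ xs ∘ <⇒≤) (AllPairs-reverse⁺ (Linked⇒AllPairs <-trans sorted)))

cellsFrom : ℕ → List ℕ → ℕ
cellsFrom d rows = sum (map (_∸ d) rows)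

cellsFrom-suc : ∀ d rows → cellsFrom d rows ≡ length (filter (d <?_) rows) + cellsFrom (suc d) rows
cellsFrom-suc d []         = refl
cellsFrom-suc d (r ∷ rows) with d <? r
... | yes d<r = begin
  r ∸ d + cellsFrom d rows                                          ≡⟨ cong₂ _+_ (+-∸-assoc 1 d<r) (cellsFrom-suc d rows) ⟩
  suc (r ∸ suc d) + (count rows + cellsFrom (suc d) rows)           ≡⟨ cong suc (+-leftComm (r ∸ suc d) (count rows) (cellsFrom (suc d) rows)) ⟩
  suc (count rows) + (r ∸ suc d + cellsFrom (suc d) rows)
    ≡⟨ cong (λ rs → length rs + (r ∸ suc d + cellsFrom (suc d) rows)) (filter-accept (d <?_) {xs = rows} d<r) ⟨
  count (r ∷ rows) + (r ∸ suc d + cellsFrom (suc d) rows)           ∎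
  where
  open ≡-Reasoning
  count : List ℕ → ℕ
  count rs = length (filter (d <?_) rs)
... | no  d≮r = begin
  r ∸ d + cellsFrom d rows                                          ≡⟨ cong₂ _+_ (m≤n⇒m∸n≡0 r≤d) (cellsFrom-suc d rows) ⟩
  count rows + cellsFrom (suc d) rows
    ≡⟨ cong₂ (λ rs z → length rs + (z + cellsFrom (suc d) rows))
             (filter-reject (d <?_) {xs = rows} d≮r) (m≤n⇒m∸n≡0 (m≤n⇒m≤1+n r≤d)) ⟨
  count (r ∷ rows) + (r ∸ suc d + cellsFrom (suc d) rows)           ∎
  where
  open ≡-Reasoning
  count : List ℕ → ℕ
  count rs = length (filter (d <?_) rs)
  r≤d : r ≤ d
  r≤d = ≮⇒≥ d≮r

cellsFrom-short : ∀ {d rows} → All (_≤ d) rows → cellsFrom d rows ≡ 0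
cellsFrom-short []             = refl
cellsFrom-short (r≤d ∷ rows≤d) = cong₂ _+_ (m≤n⇒m∸n≡0 r≤d) (cellsFrom-short rows≤d)

diagHookSumFrom≡cellsFrom : ∀ d rows → AllPairs _≥_ rows → diagHookSumFrom d rows ≡ cellsFrom d rows
diagHookSumFrom≡cellsFrom d []         _                         = refl
diagHookSumFrom≡cellsFrom d (r ∷ rows) (r≥rows ∷ decreasing) with d <? r
... | yes d<r = begin
  r ∸ suc d + count + 1 + diagHookSumFrom (suc d) rows ≡⟨ cong (r ∸ suc d + count + 1 +_) (diagHookSumFrom≡cellsFrom (suc d) rows decreasing) ⟩
  r ∸ suc d + count + 1 + cellsFrom (suc d) rows      ≡⟨ rearrange (r ∸ suc d) count _ ⟩
  suc (r ∸ suc d) + (count + cellsFrom (suc d) rows)  ≡⟨ cong₂ _+_ (+-∸-assoc 1 d<r) (cellsFrom-suc d rows) ⟨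
  r ∸ d + cellsFrom d rows                            ∎
  where
  open ≡-Reasoning
  count : ℕ
  count = length (filter (d <?_) rows)
  rearrange : ∀ a b c → a + b + 1 + c ≡ suc a + (b + c)
  rearrange = solve-∀
... | no  d≮r = begin
  diagHookSumFrom (suc d) rows ≡⟨ diagHookSumFrom≡cellsFrom (suc d) rows decreasing ⟩
  cellsFrom (suc d) rows       ≡⟨ cellsFrom-short (All.map (λ r′≤r → ≤-trans r′≤r (m≤n⇒m≤1+n r≤d)) r≥rows) ⟩
  0                            ≡⟨ cellsFrom-short (r≤d ∷ All.map (λ r′≤r → ≤-trans r′≤r r≤d) r≥rows) ⟨
  r ∸ d + cellsFrom d rows     ∎
  where
  open ≡-Reasoning
  r≤d : r ≤ d
  r≤d = ≮⇒≥ d≮r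

diagHookSum≡cells : ∀ rows → AllPairs _≥_ rows → diagHookSum rows ≡ cells rows
diagHookSum≡cells rows decreasing = trans (diagHookSumFrom≡cellsFrom 0 rows decreasing) (cong sum (map-id rows))

-- Distinct partitions

module DistinctPartition {lam : List ℕ} (dp : IsDistinctPartition lam) where

  private
    m : ℕ
    m = largest lam
    sorted : Linked _<_ lam
    sorted = proj₁ dp

    unique : Unique lam
    unique = AllPairs.map <⇒≢ (Linked⇒AllPairs <-trans sorted)

    m∈lam : m ∈ lam
    m∈lam = largest-∈ (≤-trans (s≤s z≤n) (proj₂ (proj₂ dp)))

    lam<1+m : All (_< suc m) lam
    lam<1+m = All.map s≤s (≤-largest sorted)

    0∉lam : 0 ∉ lam
    0∉lam 0∈lam = <-irrefl refl (All.lookup (proj₁ (proj₂ dp)) 0∈lam)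

  row : ℕ → ℕ
  row g = ∑[ x < g ] χᶜ lam x

  sum≡∑ : sum lam ≡ ∑[ x < suc m ] (χ lam x * x)
  sum≡∑ = trans (cong sum (sym (map-id lam))) (sum-map≡∑χ (suc m) id unique lam<1+m)

  length≡∑ : length lam ≡ ∑[ x < suc m ] χ lam x
  length≡∑ = begin
    length lam                         ≡⟨ length≡sum-map-1 lam ⟩
    sum (map (λ _ → 1) lam)            ≡⟨ sum-map≡∑χ (suc m) (λ _ → 1) unique lam<1+m ⟩
    ∑[ x < suc m ] (χ lam x * 1)       ≡⟨ ∑-cong (suc m) (λ x _ → *-identityʳ (χ lam x)) ⟩
    ∑[ x < suc m ] χ lam x             ∎
    where
    open ≡-Reasoning
    length≡sum-map-1 : ∀ xs → length xs ≡ sum (map (λ _ → 1) xs)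
    length≡sum-map-1 []       = refl
    length≡sum-map-1 (_ ∷ xs) = cong suc (length≡sum-map-1 xs)

  cells≡∑ : cells (youngRows lam) ≡ ∑[ g < suc m ] (χ lam g * row g)
  cells≡∑ = begin
    sum (map (rowLength lam) (reverse lam)) ≡⟨ cong sum (reverse-map (rowLength lam) lam) ⟩
    sum (reverse (map (rowLength lam) lam)) ≡⟨ sum-↭ (↭-reverse (map (rowLength lam) lam)) ⟩
    sum (map (rowLength lam) lam)           ≡⟨ sum-map≡∑χ (suc m) (rowLength lam) unique lam<1+m ⟩
    ∑[ g < suc m ] (χ lam g * rowLength lam g) ≡⟨ ∑-cong (suc m) (λ g _ → cong (χ lam g *_) (rowLength≡∑ lam g)) ⟩
    ∑[ g < suc m ] (χ lam g * row g)        ∎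
    where open ≡-Reasoning

  sum≡tri+cells : sum lam ≡ tri (length lam) + cells (youngRows lam)
  sum≡tri+cells = begin
    sum lam                                               ≡⟨ sum≡∑ ⟩
    ∑[ x < suc m ] (χ lam x * x)                          ≡⟨ ∑-positions (χ+χᶜ≡1 {lam}) (suc m) ⟩
    tri (∑[ x < suc m ] χ lam x) + ∑[ g < suc m ] (χ lam g * row g) ≡⟨ cong₂ (λ t c → tri t + c) length≡∑ cells≡∑ ⟨
    tri (length lam) + cells (youngRows lam)              ∎
    where open ≡-Reasoning

  missing≡∑ : length (missing lam) ≡ ∑[ x < m ] χᶜ lam (suc x)
  missing≡∑ = trans (cong (λ l → length (filter (λ s → ¬? (s ∈? lam)) l)) (map-upTo suc m))
                    (length-filter-∉ lam m suc)

  missing+length≡largest : length (missing lam) + length lam ≡ m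
  missing+length≡largest = suc-injective (begin
    suc (length (missing lam) + length lam)                  ≡⟨ cong₂ (λ a b → suc (a + b)) missing≡∑ length≡∑ ⟩
    1 + ∑[ x < m ] χᶜ lam (suc x) + ∑[ x < suc m ] χ lam x
      ≡⟨ cong (λ c → c + ∑[ x < m ] χᶜ lam (suc x) + ∑[ x < suc m ] χ lam x) (χᶜ-∉ {lam} 0∉lam) ⟨
    χᶜ lam 0 + ∑[ x < m ] χᶜ lam (suc x) + ∑[ x < suc m ] χ lam x ≡⟨ cong (_+ ∑[ x < suc m ] χ lam x) (∑-shift m {χᶜ lam}) ⟨
    ∑[ x < suc m ] χᶜ lam x + ∑[ x < suc m ] χ lam x         ≡⟨ +-comm (∑< (suc m) (χᶜ lam)) _ ⟩
    ∑[ x < suc m ] χ lam x + ∑[ x < suc m ] χᶜ lam x         ≡⟨ ∑-complement (χ+χᶜ≡1 {lam}) (suc m) ⟩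
    suc m                                                    ∎)
    where open ≡-Reasoning

  largest≤cells : m ≤ cells (youngRows lam)
  largest≤cells = begin
    m                                              ≡⟨ ∑-complement (χ+χᶜ≡1 {lam}) m ⟨
    ∑[ x < m ] χ lam x + row m                     ≤⟨ +-monoˡ-≤ (row m) (∑-mono-≤ m (λ g _ → χ≤χ*row g)) ⟩
    ∑[ g < m ] (χ lam g * row g) + row m           ≡⟨ cong (∑[ g < m ] (χ lam g * row g) +_) (*-identityˡ (row m)) ⟨
    ∑[ g < m ] (χ lam g * row g) + 1 * row m       ≡⟨ cong (λ c → ∑[ g < m ] (χ lam g * row g) + c * row m) (χ-∈ {lam} m∈lam) ⟨
    ∑[ g < suc m ] (χ lam g * row g)               ≡⟨ cells≡∑ ⟨
    cells (youngRows lam)                          ∎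
    where
    open ≤-Reasoning
    -- 0 ∈ S_λ puts a cell in every row, and the top row alone has m − (t − 1) cells.
    1≤row : ∀ {g} → g ∈ lam → 1 ≤ row g
    1≤row {zero}  0∈lam = contradiction 0∈lam 0∉lam
    1≤row {suc g} _     = subst (_≤ row (suc g)) (χᶜ-∉ {lam} 0∉lam) (∑-prefix-≤ {1} {suc g} {χᶜ lam} (s≤s z≤n))
    χ≤χ*row : ∀ g → χ lam g ≤ χ lam g * row g
    χ≤χ*row g with g ∈? lam
    ... | yes g∈lam = subst (1 ≤_) (sym (*-identityˡ (row g))) (1≤row g∈lam)
    ... | no  _     = z≤n

  sum≡inner+largest : ∀ {m′} → m ≡ suc m′ → sum lam ≡ ∑[ x < m′ ] (χ lam (suc x) * suc x) + m
  sum≡inner+largest {m′} m≡ = begin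
    sum lam                                           ≡⟨ sum≡∑ ⟩
    ∑[ x < m ] (χ lam x * x) + χ lam m * m            ≡⟨ cong₂ _+_ drop-zero (trans (cong (_* m) (χ-∈ {lam} m∈lam)) (*-identityˡ m)) ⟩
    ∑[ x < m′ ] (χ lam (suc x) * suc x) + m           ∎
    where
    open ≡-Reasoning
    drop-zero : ∑[ x < m ] (χ lam x * x) ≡ ∑[ x < m′ ] (χ lam (suc x) * suc x)
    drop-zero = trans (cong (λ k → ∑[ x < k ] (χ lam x * x)) m≡)
                      (trans (∑-shift m′) (cong (_+ ∑[ x < m′ ] (χ lam (suc x) * suc x)) (*-zeroʳ (χ lam 0))))

  missing≡inner : ∀ {m′} → m ≡ suc m′ → length (missing lam) ≡ ∑[ x < m′ ] χᶜ lam (suc x)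
  missing≡inner {m′} m≡ = begin
    length (missing lam)                              ≡⟨ missing≡∑ ⟩
    ∑[ x < m ] χᶜ lam (suc x)                         ≡⟨ cong (λ k → ∑[ x < k ] χᶜ lam (suc x)) m≡ ⟩
    ∑[ x < m′ ] χᶜ lam (suc x) + χᶜ lam (suc m′)      ≡⟨ cong (∑[ x < m′ ] χᶜ lam (suc x) +_) (subst (λ k → χᶜ lam k ≡ 0) m≡ (χᶜ-∈ {lam} m∈lam)) ⟩
    ∑[ x < m′ ] χᶜ lam (suc x) + 0                    ≡⟨ +-identityʳ _ ⟩
    ∑[ x < m′ ] χᶜ lam (suc x)                        ∎
    where open ≡-Reasoning

  pair-contribution : ∀ {a d} → χᶜ lam a + χᶜ lam (a + d) ≡ 1 →
                      χ lam a * a + χ lam (a + d) * (a + d) ≡ a + d * χ lam (a + d)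
  pair-contribution {a} {d} one-missing = one-of-two (χ lam a) (χ lam (a + d)) exactly-one-part
    where
    open ≡-Reasoning
    exactly-one-part : χ lam a + χ lam (a + d) ≡ 1
    exactly-one-part = +-cancelʳ-≡ 1 _ _ (begin
      χ lam a + χ lam (a + d) + 1                                 ≡⟨ cong (χ lam a + χ lam (a + d) +_) one-missing ⟨
      χ lam a + χ lam (a + d) + (χᶜ lam a + χᶜ lam (a + d))       ≡⟨ +-interchange (χ lam a) _ _ _ ⟩
      χ lam a + χᶜ lam a + (χ lam (a + d) + χᶜ lam (a + d))       ≡⟨ cong₂ _+_ (χ+χᶜ≡1 {lam} a) (χ+χᶜ≡1 {lam} (a + d)) ⟩
      1 + 1                                                       ∎)
    one-of-two : ∀ u v → u + v ≡ 1 → u * a + v * (a + d) ≡ a + d * v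
    one-of-two zero       (suc zero) _ = rearrange a d
      where rearrange : ∀ a d → a + d + 0 ≡ a + d * 1
            rearrange = solve-∀
    one-of-two (suc zero) zero       _ = rearrange a d
      where rearrange : ∀ a d → a + 0 + 0 ≡ a + d * 0
            rearrange = solve-∀
    one-of-two zero          zero          ()
    one-of-two zero          (suc (suc _)) ()
    one-of-two (suc zero)    (suc _)       ()
    one-of-two (suc (suc _)) _             ()

  ceil-half : length (missing lam) ≡ m / 2 →
              (m ≡ length lam + length lam × length (missing lam) ≡ length lam) ⊎
              (suc m ≡ length lam + length lam × suc (length (missing lam)) ≡ length lam)
  ceil-half M≡h with half-parity m
  ... | inj₁ m≡h+h = inj₁ (subst (λ k → m ≡ k + k) h≡t m≡h+h , trans M≡h h≡t)
    where
    h≡t : m / 2 ≡ length lam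
    h≡t = +-cancelˡ-≡ (m / 2) _ _ (trans (sym m≡h+h) (trans (sym missing+length≡largest) (cong (_+ length lam) M≡h)))
  ... | inj₂ m≡1+h+h = inj₂ ( subst (λ k → suc m ≡ k + k) 1+h≡t (cong suc (trans m≡1+h+h (sym (+-suc (m / 2) (m / 2)))))
                             , trans (cong suc M≡h) 1+h≡t )
    where
    1+h≡t : suc (m / 2) ≡ length lam
    1+h≡t = +-cancelˡ-≡ (m / 2) _ _ (begin
      m / 2 + suc (m / 2)                ≡⟨ +-suc (m / 2) (m / 2) ⟩
      suc (m / 2 + m / 2)                ≡⟨ m≡1+h+h ⟨
      m                                  ≡⟨ missing+length≡largest ⟨
      length (missing lam) + length lam  ≡⟨ cong (_+ length lam) M≡h ⟩
      m / 2 + length lam                 ∎)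
      where open ≡-Reasoning

  module _ (unrefinable : Unrefinable lam) where

    missing-pair≤1 : ∀ {a d} → 0 < a → 0 < d → a + (a + d) ≡ m → χᶜ lam a + χᶜ lam (a + d) ≤ 1
    missing-pair≤1 {a} {d} 0<a 0<d pair≡m = by-cases (a ∈? lam) (a + d ∈? lam)
      where
      by-cases : Dec (a ∈ lam) → Dec (a + d ∈ lam) → χᶜ lam a + χᶜ lam (a + d) ≤ 1
      by-cases (yes a∈lam) _ = subst (λ c → c + χᶜ lam (a + d) ≤ 1) (sym (χᶜ-∈ {lam} a∈lam)) (χᶜ≤1 (a + d))
      by-cases (no a∉lam) (yes b∈lam) =
        subst₂ (λ c c′ → c + c′ ≤ 1) (sym (χᶜ-∉ {lam} a∉lam)) (sym (χᶜ-∈ {lam} b∈lam)) ≤-refl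
      by-cases (no a∉lam) (no b∉lam) = contradiction (subst (_∈ lam) (sym pair≡m) m∈lam)
        (unrefinable a (a + d)
          (∈-missing 0<a (subst (a ≤_) pair≡m (m≤m+n a (a + d))) a∉lam)
          (∈-missing (<-≤-trans 0<a (m≤m+n a d)) (subst (a + d ≤_) pair≡m (m≤n+m (a + d) a)) b∉lam)
          (<⇒≢ (m<m+n a 0<d)))

    evenLargest-pairs : ∀ {i} → m ≡ suc (suc (i + i)) → length (missing lam) ≡ suc i →
                        (∀ a → a < i → χᶜ lam (suc a) + χᶜ lam (suc a + 2 * (i ∸ a)) ≡ 1) × χᶜ lam (suc i) ≡ 1
    evenLargest-pairs {i} m≡ missing≡ = each-pair-one-missing , middle-missing
      where
      missing-pair : ℕ → ℕ
      missing-pair a = χᶜ lam (suc a) + χᶜ lam (suc a + 2 * (i ∸ a))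
      P : ℕ
      P = ∑[ a < i ] missing-pair a

      pairs+middle : P + χᶜ lam (suc i) ≡ suc i
      pairs+middle = trans (sym (∑-pairUp-odd i)) (trans (sym (missing≡inner m≡)) missing≡)

      pair≤1 : ∀ a → a < i → missing-pair a ≤ 1
      pair≤1 a a<i = missing-pair≤1 (s≤s z≤n) 0<d (trans pair-sum (sym m≡))
        where
        0<d : 0 < 2 * (i ∸ a)
        0<d = ≤-trans (m<n⇒0<n∸m a<i) (m≤m+n (i ∸ a) _)
        pair-sum : suc a + (suc a + 2 * (i ∸ a)) ≡ suc (suc (i + i))
        pair-sum = trans (cong suc (+-suc a _)) (cong (suc ∘ suc) (ordered-pair-sum (<⇒≤ a<i)))

      i≤P : i ≤ P
      i≤P = ≤-pred (begin
        suc i                  ≡⟨ pairs+middle ⟨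
        P + χᶜ lam (suc i)     ≤⟨ +-monoʳ-≤ P (χᶜ≤1 (suc i)) ⟩
        P + 1                  ≡⟨ +-comm P 1 ⟩
        suc P                  ∎)
        where open ≤-Reasoning

      each-pair-one-missing : ∀ a → a < i → missing-pair a ≡ 1
      each-pair-one-missing = ∑-saturated i pair≤1 i≤P

      middle-missing : χᶜ lam (suc i) ≡ 1
      middle-missing = +-cancelˡ-≡ i _ _ (begin
        i + χᶜ lam (suc i)     ≡⟨ cong (_+ χᶜ lam (suc i)) P≡i ⟨
        P + χᶜ lam (suc i)     ≡⟨ pairs+middle ⟩
        suc i                  ≡⟨ +-comm 1 i ⟩
        i + 1                  ∎)
        where
        open ≡-Reasoning
        P≡i : P ≡ i
        P≡i = trans (∑-cong i each-pair-one-missing) (trans (∑-const i 1) (*-identityʳ i))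

    sum≢tri-evenLargest : ∀ {i} → m ≡ suc (suc (i + i)) → length (missing lam) ≡ suc i → sum lam ≢ tri (3 + i)
    sum≢tri-evenLargest {i} m≡ missing≡ sum≡ = even≢odd K 0 2K≡1
      where
      d : ℕ → ℕ
      d a = 2 * (i ∸ a)
      K : ℕ
      K = ∑[ a < i ] ((i ∸ a) * χ lam (suc a + d a))

      inner : ∑[ x < suc (i + i) ] (χ lam (suc x) * suc x) ≡ tri (suc i) + 2 * K
      inner = begin
        ∑[ x < suc (i + i) ] (χ lam (suc x) * suc x)                                          ≡⟨ ∑-pairUp-odd i ⟩
        ∑[ a < i ] (χ lam (suc a) * suc a + χ lam (suc a + d a) * (suc a + d a)) + χ lam (suc i) * suc i
                                                                                             ≡⟨ cong₂ _+_ (∑-cong i pair-term) middle-term ⟩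
        ∑[ a < i ] (suc a + 2 * ((i ∸ a) * χ lam (suc a + d a))) + 0                         ≡⟨ +-identityʳ _ ⟩
        ∑[ a < i ] (suc a + 2 * ((i ∸ a) * χ lam (suc a + d a)))                             ≡⟨ ∑-distrib-+ i ⟩
        ∑[ a < i ] suc a + ∑[ a < i ] (2 * ((i ∸ a) * χ lam (suc a + d a)))                  ≡⟨ cong₂ _+_ (∑-suc≡tri i) (∑-distribˡ-* 2 i) ⟩
        tri (suc i) + 2 * K                                                                   ∎
        where
        open ≡-Reasoning
        pair-term : ∀ a → a < i → χ lam (suc a) * suc a + χ lam (suc a + d a) * (suc a + d a)
                                ≡ suc a + 2 * ((i ∸ a) * χ lam (suc a + d a))
        pair-term a a<i = trans (pair-contribution (proj₁ (evenLargest-pairs m≡ missing≡) a a<i))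
                                (cong (suc a +_) (*-assoc 2 (i ∸ a) _))
        middle-term : χ lam (suc i) * suc i ≡ 0
        middle-term = cong (_* suc i) (χ-∉ {lam} (χᶜ≡1⇒∉ (proj₂ (evenLargest-pairs m≡ missing≡))))

      2K≡1 : 2 * K ≡ 1
      2K≡1 = +-cancelˡ-≡ (tri (suc i)) _ _ (+-cancelʳ-≡ m _ _ (begin
        tri (suc i) + 2 * K + m                                  ≡⟨ cong (_+ m) inner ⟨
        ∑[ x < suc (i + i) ] (χ lam (suc x) * suc x) + m         ≡⟨ sum≡inner+largest m≡ ⟨
        sum lam                                                  ≡⟨ sum≡ ⟩
        tri (suc i) + suc i + suc (suc i)                        ≡⟨ rearrange (tri (suc i)) i ⟩
        tri (suc i) + 1 + suc (suc (i + i))                      ≡⟨ cong (tri (suc i) + 1 +_) m≡ ⟨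
        tri (suc i) + 1 + m                                      ∎))
        where
        open ≡-Reasoning
        rearrange : ∀ t i → t + suc i + suc (suc i) ≡ t + 1 + suc (suc (i + i))
        rearrange = solve-∀

    oddLargest-pairs : ∀ {j} → m ≡ suc (j + j) → length (missing lam) ≡ j →
                       ∀ a → a < j → χᶜ lam (suc a) + χᶜ lam (suc a + suc (2 * (j ∸ suc a))) ≡ 1
    oddLargest-pairs {j} m≡ missing≡ = ∑-saturated j pair≤1 (≤-reflexive (sym pairs))
      where
      missing-pair : ℕ → ℕ
      missing-pair a = χᶜ lam (suc a) + χᶜ lam (suc a + suc (2 * (j ∸ suc a)))

      pairs : ∑[ a < j ] missing-pair a ≡ j
      pairs = trans (sym (∑-pairUp j)) (trans (sym (missing≡inner m≡)) missing≡)

      pair≤1 : ∀ a → a < j → missing-pair a ≤ 1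
      pair≤1 a a<j = missing-pair≤1 (s≤s z≤n) (s≤s z≤n) (trans pair-sum (sym m≡))
        where
        pair-sum : suc a + (suc a + suc (2 * (j ∸ suc a))) ≡ suc (j + j)
        pair-sum = trans (cong (suc a +_) (+-suc (suc a) _))
                         (trans (+-suc (suc a) _) (cong suc (ordered-pair-sum a<j)))

    sum≢tri-oddLargest : ∀ {j} → m ≡ suc (j + j) → length (missing lam) ≡ j → sum lam ≢ tri (3 + j)
    sum≢tri-oddLargest {j} m≡ missing≡ sum≡ = ∑-odd-weights≢2 j (λ a → χ≤1 (suc a + d a)) F≡2
      where
      d : ℕ → ℕ
      d a = suc (2 * (j ∸ suc a))
      F : ℕ
      F = ∑[ a < j ] (d a * χ lam (suc a + d a))

      inner : ∑[ x < j + j ] (χ lam (suc x) * suc x) ≡ tri (suc j) + F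
      inner = begin
        ∑[ x < j + j ] (χ lam (suc x) * suc x)                                        ≡⟨ ∑-pairUp j ⟩
        ∑[ a < j ] (χ lam (suc a) * suc a + χ lam (suc a + d a) * (suc a + d a))      ≡⟨ ∑-cong j (λ a a<j → pair-contribution (oddLargest-pairs m≡ missing≡ a a<j)) ⟩
        ∑[ a < j ] (suc a + d a * χ lam (suc a + d a))                                ≡⟨ ∑-distrib-+ j ⟩
        ∑[ a < j ] suc a + F                                                          ≡⟨ cong (_+ F) (∑-suc≡tri j) ⟩
        tri (suc j) + F                                                               ∎
        where open ≡-Reasoning

      F≡2 : F ≡ 2
      F≡2 = +-cancelˡ-≡ (tri (suc j)) _ _ (+-cancelʳ-≡ m _ _ (begin
        tri (suc j) + F + m                                ≡⟨ cong (_+ m) inner ⟨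
        ∑[ x < j + j ] (χ lam (suc x) * suc x) + m         ≡⟨ sum≡inner+largest m≡ ⟨
        sum lam                                            ≡⟨ sum≡ ⟩
        tri (suc j) + suc j + suc (suc j)                  ≡⟨ rearrange (tri (suc j)) j ⟩
        tri (suc j) + 2 + suc (j + j)                      ≡⟨ cong (tri (suc j) + 2 +_) m≡ ⟨
        tri (suc j) + 2 + m                                ∎))
        where
        open ≡-Reasoning
        rearrange : ∀ t j → t + suc j + suc (suc j) ≡ t + 2 + suc (j + j)
        rearrange = solve-∀

    sum≢tri[2+length] : length (missing lam) ≡ m / 2 → sum lam ≢ tri (2 + length lam)
    sum≢tri[2+length] M≡m/2 with length lam in t≡ | ceil-half M≡m/2
    ... | zero  | _                        = contradiction (subst (2 ≤_) t≡ (proj₂ (proj₂ dp))) λ ()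
    ... | suc i | inj₁ (m≡t+t , M≡t)       = sum≢tri-evenLargest (trans m≡t+t (cong suc (+-suc i i))) M≡t
    ... | suc j | inj₂ (1+m≡t+t , 1+M≡t)   = sum≢tri-oddLargest (suc-injective (trans 1+m≡t+t (cong suc (+-suc j j)))) (suc-injective 1+M≡t)

-- Maximal unrefinable partitions of T n

-- (1, …, n − 3, n + 1, 2n − 4) for n = 7 + q
witness : ℕ → List ℕ
witness q = applyUpTo suc (4 + q) ++ (8 + q) ∷ (10 + q + q) ∷ []

witness-largest : ∀ q → largest (witness q) ≡ (5 + q) + (5 + q)
witness-largest q = trans (largest-++ (applyUpTo suc (4 + q)) (8 + q) _) (rearrange q)
  where
  rearrange : ∀ q → 10 + q + q ≡ (5 + q) + (5 + q)
  rearrange = solve-∀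

witness-isDistinctPartition : ∀ q → IsDistinctPartition (witness q)
witness-isDistinctPartition q = AllPairs⇒Linked ordered , positive , length≥2
  where
  5+q≤10+2q : 5 + q ≤ 10 + q + q
  5+q≤10+2q = ≤-trans (+-monoˡ-≤ q (m≤m+n 5 5)) (m≤m+n (10 + q) q)
  ordered : AllPairs _<_ (witness q)
  ordered = AllPairs.++⁺ (AllPairs.applyUpTo⁺₁ suc (4 + q) (λ i<j _ → s≤s i<j))
                         ((s≤s (≤-trans (n≤1+n (8 + q)) (m≤m+n (9 + q) q)) ∷ []) ∷ [] ∷ [])
                         (All.applyUpTo⁺₁ suc (4 + q) (λ i<4+q →
                            ≤-trans (s≤s i<4+q) (+-monoˡ-≤ q (m≤m+n 5 3)) ∷ ≤-trans (s≤s i<4+q) 5+q≤10+2q ∷ []))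
  positive : All (0 <_) (witness q)
  positive = All.++⁺ (All.applyUpTo⁺₂ suc (4 + q) (λ _ → s≤s z≤n)) (s≤s z≤n ∷ s≤s z≤n ∷ [])
  length≥2 : 2 ≤ length (witness q)
  length≥2 = subst (2 ≤_) (sym (length-++ (applyUpTo suc (4 + q)))) (m≤n+m 2 (length (applyUpTo suc (4 + q))))

witness-sum : ∀ q → sum (witness q) ≡ T (7 + q)
witness-sum q = begin
  sum (applyUpTo suc (4 + q) ++ (8 + q) ∷ (10 + q + q) ∷ [])   ≡⟨ sum-++ (applyUpTo suc (4 + q)) _ ⟩
  sum (applyUpTo suc (4 + q)) + (8 + q + (10 + q + q + 0))    ≡⟨ cong (_+ (8 + q + (10 + q + q + 0))) (trans (sum-applyUpTo (4 + q) suc) (∑-suc≡tri (4 + q))) ⟩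
  tri (5 + q) + (8 + q + (10 + q + q + 0))                     ≡⟨ rearrange (tri (5 + q)) q ⟩
  tri (5 + q) + (5 + q) + (6 + q) + (7 + q)                    ≡⟨ T≡tri (7 + q) ⟨
  T (7 + q)                                                    ∎
  where
  open ≡-Reasoning
  rearrange : ∀ t q → t + (8 + q + (10 + q + q + 0)) ≡ t + (5 + q) + (6 + q) + (7 + q)
  rearrange = solve-∀

witness-unrefinable : ∀ q → Unrefinable (witness q)
witness-unrefinable q a b a∈ b∈ a≢b a+b∈ = <⇒≱ (s≤s (≤-trans a+b≤largest (≤-reflexive (witness-largest q))))
  (distinct-sum (large a∈) (large b∈) a≢b)
  where
  a+b≤largest : a + b ≤ largest (witness q)
  a+b≤largest = All.lookup (≤-largest (proj₁ (witness-isDistinctPartition q))) a+b∈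
  large : ∀ {x} → x ∈ missing (witness q) → 5 + q ≤ x
  large {x} x∈ with ∈-missing⁻ {witness q} x∈
  ... | 0<x , x∉ = ≮⇒≥ λ x<5+q → x∉ (∈-++⁺ˡ (small 0<x x<5+q))
    where
    small : ∀ {x} → 0 < x → x < 5 + q → x ∈ applyUpTo suc (4 + q)
    small {suc x} _ (s≤s x<4+q) = ∈-applyUpTo⁺ suc x<4+q

Ubar-length : ∀ q {lam} → InUbar (T (7 + q)) lam → length lam ≡ 5 + q
Ubar-length q {lam} ((dp , sum≡T , unrefinable , maximal) , M≡m/2) = ≤∧<2+∧≢1+⇒≡ 5+q≤t t<7+q t≢6+q
  where
  open DistinctPartition dp
  t m : ℕ
  t = length lam
  m = largest lam

  sum≡tri : sum lam ≡ tri (8 + q)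
  sum≡tri = trans sum≡T (T≡tri (7 + q))

  10+2q≤m : (5 + q) + (5 + q) ≤ m
  10+2q≤m = subst (_≤ m) (witness-largest q)
             (maximal (witness q) (witness-isDistinctPartition q) (witness-sum q) (witness-unrefinable q))

  m≤t+t≤1+m : m ≤ t + t × t + t ≤ suc m
  m≤t+t≤1+m with ceil-half M≡m/2
  ... | inj₁ (m≡t+t , _)   = ≤-reflexive m≡t+t , ≤-trans (≤-reflexive (sym m≡t+t)) (n≤1+n m)
  ... | inj₂ (1+m≡t+t , _) = ≤-trans (n≤1+n m) (≤-reflexive 1+m≡t+t) , ≤-reflexive (sym 1+m≡t+t)

  5+q≤t : 5 + q ≤ t
  5+q≤t = half-≤ (≤-trans 10+2q≤m (proj₁ m≤t+t≤1+m))

  t<7+q : t < 7 + q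
  t<7+q = tri-bound (s≤s (s≤s z≤n)) (begin
    tri t + (t + t)                        ≤⟨ +-monoʳ-≤ (tri t) (≤-trans (proj₂ m≤t+t≤1+m) (s≤s largest≤cells)) ⟩
    tri t + suc (cells (youngRows lam))    ≡⟨ +-suc (tri t) _ ⟩
    suc (tri t + cells (youngRows lam))    ≡⟨ cong suc (trans (sym sum≡tri+cells) sum≡tri) ⟩
    suc (tri (8 + q))                      ∎)
    where open ≤-Reasoning

  t≢6+q : t ≢ 6 + q
  t≢6+q t≡6+q = sum≢tri[2+length] unrefinable M≡m/2 (trans sum≡tri (cong (λ k → tri (2 + k)) (sym t≡6+q)))

Ubar-cells : ∀ n {lam} → 7 ≤ n → InUbar (T n) lam → cells (youngRows lam) ≡ 3 * n ∸ 3
Ubar-cells n {lam} 7≤n ubar with m≤n⇒∃[o]m+o≡n 7≤n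
... | q , refl = +-cancelˡ-≡ (tri (5 + q)) _ _ (begin
  tri (5 + q) + cells (youngRows lam)        ≡⟨ cong (λ k → tri k + cells (youngRows lam)) (Ubar-length q ubar) ⟨
  tri (length lam) + cells (youngRows lam)   ≡⟨ sum≡tri+cells ⟨
  sum lam                                    ≡⟨ proj₁ (proj₂ (proj₁ ubar)) ⟩
  T (7 + q)                                  ≡⟨ T≡tri (7 + q) ⟩
  tri (5 + q) + (5 + q) + (6 + q) + (7 + q)  ≡⟨ +-assoc₃ (tri (5 + q)) (5 + q) (6 + q) (7 + q) ⟩
  tri (5 + q) + ((5 + q) + (6 + q) + (7 + q)) ≡⟨ cong (tri (5 + q) +_) (3n-3 q) ⟨
  tri (5 + q) + (3 * (7 + q) ∸ 3)            ∎)
  where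
  open ≡-Reasoning
  open DistinctPartition (proj₁ (proj₁ ubar))
  +-assoc₃ : ∀ t a b c → t + a + b + c ≡ t + (a + b + c)
  +-assoc₃ = solve-∀
  3n-3 : ∀ q → 3 * (7 + q) ∸ 3 ≡ (5 + q) + (6 + q) + (7 + q)
  3n-3 q = trans (cong (_∸ 3) (rearrange q)) (m+n∸m≡n 3 _)
    where
    rearrange : ∀ q → 3 * (7 + q) ≡ 3 + ((5 + q) + (6 + q) + (7 + q))
    rearrange = solve-∀

proposition3p9 : (k : ℕ) → 4 ≤ k → (lam : List ℕ) → InUbar (T (2 * k ∸ 1)) lam →
    (cells (youngRows lam) ≡ 3 * (2 * k ∸ 1) ∸ 3) ×
    (diagHookSum (youngRows lam) ≡ 3 * (2 * k ∸ 1) ∸ 3)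
proposition3p9 k 4≤k lam ubar@(((sorted , _) , _) , _) =
  cells≡ , trans (diagHookSum≡cells (youngRows lam) (youngRows-decreasing sorted)) cells≡
  where
  cells≡ : cells (youngRows lam) ≡ 3 * (2 * k ∸ 1) ∸ 3
  cells≡ = Ubar-cells (2 * k ∸ 1) (∸-monoˡ-≤ 1 (*-monoʳ-≤ 2 4≤k)) ubar
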